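{- Let $m>1$ be an odd integer. Then every positive integer $n$ satisfies $D_m(n)<n$.
   Context: For $m,n\in\mathbb{N}$, the Schemmel totient function $L_m(n)$ is the number of integers $k\in\{1,\dots,n\}$ such that $\gcd(k+s,n)=1$ for all $s\in\{0,1,\dots,m-1\}$; by convention $L_m(0)=0$. Equivalently, $L_m(1)=1$, and for $n>1$ with $n=\prod_{i=1}^r p_i^{\alpha_i}$, $L_m(n)=0$ if the smallest prime factor of $n$ is $\le m$, and $L_m(n)=\prod_{i} p_i^{\alpha_i-1}(p_i-m)$ otherwise. Iterates: $f^{(1)}=f$, $f^{(k+1)}=f\circ f^{(k)}$. $R_m(n)$ is the least positive integer $k$ with $L_m^{(k)}(n)\in\{0,1\}$. Define $D_m(1)=0$ and $D_m(n)=\sum_{i=1}^{R_m(n)}L_m^{(i)}(n)$ for $n>1$. -}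

module Defs where

open import Data.Nat.Base using (ℕ; zero; suc; _+_; _*_; _≤_; _<_; _≡ᵇ_)
open import Data.Nat.GCD using (gcd)
open import Data.List.Base using (List; length; filterᵇ; upTo; map)
open import Data.Nat.ListAction using (sum)
open import Data.Bool.ListAction using (all)
open import Data.Product using (_×_; ∃)
open import Data.Sum using (_⊎_)
open import Relation.Binary.PropositionalEquality using (_≡_)

-- Schemmel totient, by its defining count:
-- L m n = #{ k ∈ {1,…,n} : gcd (k + s) n ≡ 1 for all s ∈ {0,…,m-1} }.
-- (For n = 0 the range is empty, so L m 0 = 0, matching the convention.)
L : ℕ → ℕ → ℕ
L m n = length (filterᵇ (λ k → all (λ s → gcd (k + s) n ≡ᵇ 1) (upTo m))
                        (map suc (upTo n)))

iter : ℕ → ℕ → ℕ → ℕ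
iter m zero    n = n
iter m (suc k) n = L m (iter m k n)

ZeroOrOne : ℕ → Set
ZeroOrOne x = x ≡ 0 ⊎ x ≡ 1

IsR : ℕ → ℕ → ℕ → Set
IsR m n k = 1 ≤ k × ZeroOrOne (iter m k n)
          × (∀ j → 1 ≤ j → j < k → ZeroOrOne (iter m j n) → Data.Empty.⊥)
  where import Data.Empty

iterSum : ℕ → ℕ → ℕ → ℕ
iterSum m n k = sum (map (λ i → iter m (suc i) n) (upTo k))

IsD : ℕ → ℕ → ℕ → Set
IsD m n d = (n ≡ 1 × d ≡ 0)
          ⊎ (1 < n × ∃ (λ k → IsR m n k × d ≡ iterSum m n k))

Odd : ℕ → Set
Odd m = ∃ (λ t → m ≡ 1 + 2 * t)

module Submission where

-- For n ≥ 2 the residue k = n is never admissible (its window contains n itself), so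
-- L_m(n) < n.  If n is even, every window k, k+1 contains an even number, so L_m(n) = 0.
-- If n is odd, k ↦ −(k + m − 1) mod n maps admissible k to admissible k, since it reverses
-- the window k, …, k + m − 1 modulo n.  As m − 1 = 2t is even and n is odd, its only fixed
-- point is k ≡ −t, whose window contains a multiple of n; so L_m(n) is even.  Hence
-- L_m(L_m(n)) = 0, R_m(n) ≤ 2 and D_m(n) = L_m(n) < n.

open import Defs
open import Data.Nat.Base using (ℕ; zero; suc; _+_; _*_; _∸_; _≡ᵇ_; _<_; _≤_; z≤n; s≤s)
open import Data.Nat.Properties
open import Data.Nat.Divisibility
open import Data.Nat.Coprimality using (Coprime; gcd≡1⇒coprime; coprime⇒gcd≡1)
open import Data.Nat.GCD using (gcd)
open import Data.Nat.ListAction using (sum)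
open import Data.Nat.ListAction.Properties using (sum-++)
open import Data.Nat.Tactic.RingSolver using (solve-∀)
open import Data.Bool.Base using (Bool; true; false; T)
open import Data.Bool.Properties using (T-≡; ⇔→≡)
open import Data.Bool.ListAction using (all)
open import Data.List.Base using ([]; _∷_; [_]; _∷ʳ_; length; filterᵇ; upTo; map; applyUpTo)
open import Data.List.Properties
  using (applyUpTo-∷ʳ; map-applyUpTo; map-upTo; length-map; length-upTo; filter-notAll; filter-none)
open import Data.List.Membership.Propositional using (_∈_; lose)
open import Data.List.Membership.Propositional.Properties using (∈-map⁺; ∈-upTo⁺; ∈-upTo⁻)
import Data.List.Relation.Unary.All as All
open import Data.List.Relation.Unary.All.Properties using (all⁺; all⁻)
open import Data.Product using (_×_; ∃; _,_)
open import Data.Sum using (_⊎_; inj₁; inj₂)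
import Data.Sum as Sum
open import Function using (_∘_; _⇔_; mk⇔)
open import Function.Bundles using (Equivalence)
import Function.Properties.Equivalence as ⇔
open import Relation.Nullary using (¬_; contradiction; yes; no; T?)
open import Relation.Binary.PropositionalEquality
  using (_≡_; _≢_; refl; sym; trans; cong; subst; module ≡-Reasoning)

∑< : ℕ → (ℕ → ℕ) → ℕ
∑< n f = sum (applyUpTo f n)

syntax ∑< n (λ i → e) = ∑[ i < n ] e

∑-last : ∀ n (f : ℕ → ℕ) → ∑[ i < suc n ] f i ≡ ∑[ i < n ] f i + f n
∑-last n f = begin
  sum (applyUpTo f (suc n))   ≡⟨ cong sum (applyUpTo-∷ʳ f n) ⟨
  sum (applyUpTo f n ∷ʳ f n)  ≡⟨ sum-++ (applyUpTo f n) [ f n ] ⟩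
  ∑[ i < n ] f i + (f n + 0)  ≡⟨ cong (∑[ i < n ] f i +_) (+-identityʳ (f n)) ⟩
  ∑[ i < n ] f i + f n        ∎
  where open ≡-Reasoning

Periodic : ℕ → (ℕ → ℕ) → Set
Periodic n f = ∀ i → f (i + n) ≡ f i

∑-rotate-1 : ∀ n (f : ℕ → ℕ) → Periodic n f → ∑[ i < n ] f (suc i) ≡ ∑[ i < n ] f i
∑-rotate-1 zero    f per = refl
∑-rotate-1 (suc n) f per = begin
  ∑[ i < suc n ] f (suc i)          ≡⟨ ∑-last n (f ∘ suc) ⟩
  ∑[ i < n ] f (suc i) + f (suc n)  ≡⟨ cong (∑[ i < n ] f (suc i) +_) (per 0) ⟩
  ∑[ i < n ] f (suc i) + f 0        ≡⟨ +-comm _ (f 0) ⟩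
  f 0 + ∑[ i < n ] f (suc i)        ∎
  where open ≡-Reasoning

∑-rotate : ∀ r n (f : ℕ → ℕ) → Periodic n f → ∑[ i < n ] f (r + i) ≡ ∑[ i < n ] f i
∑-rotate zero    n f per = refl
∑-rotate (suc r) n f per = trans (∑-rotate r n (f ∘ suc) (per ∘ suc)) (∑-rotate-1 n f per)

2∣n+n : ∀ n → 2 ∣ n + n
2∣n+n n = subst (2 ∣_) (cong (n +_) (+-identityʳ n)) (m∣m*n n)

2∣∑-palindrome : ∀ h (g : ℕ → ℕ) → (∀ i j → suc (i + j) ≡ h + h → g i ≡ g j) →
                 2 ∣ ∑[ i < h + h ] g i
2∣∑-palindrome zero    g palindromic = 2 ∣0
2∣∑-palindrome (suc h) g palindromic =
  subst (2 ∣_) regroup (∣m∣n⇒∣m+n (2∣∑-palindrome h inner inner-palindromic) (2∣n+n (g 0)))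
  where
  inner : ℕ → ℕ
  inner i = g (suc i)
  +-suc-suc : ∀ i j → suc i + suc j ≡ suc (suc (i + j))
  +-suc-suc i j = cong suc (+-suc i j)
  inner-palindromic : ∀ i j → suc (i + j) ≡ h + h → inner i ≡ inner j
  inner-palindromic i j i+j+1≡h+h = palindromic (suc i) (suc j)
    (trans (cong suc (+-suc-suc i j)) (trans (cong (suc ∘ suc) i+j+1≡h+h) (sym (+-suc-suc h h))))
  last≡first : g (suc (h + h)) ≡ g 0
  last≡first = sym (palindromic 0 (suc (h + h)) (sym (+-suc-suc h h)))
  regroup : ∑[ i < h + h ] inner i + (g 0 + g 0) ≡ ∑[ i < suc h + suc h ] g i
  regroup = begin
    ∑[ i < h + h ] inner i + (g 0 + g 0)            ≡⟨ swap (∑[ i < h + h ] inner i) (g 0) ⟩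
    g 0 + (∑[ i < h + h ] inner i + g 0)            ≡⟨ cong (λ x → g 0 + (∑[ i < h + h ] inner i + x)) last≡first ⟨
    g 0 + (∑[ i < h + h ] inner i + inner (h + h))  ≡⟨ cong (g 0 +_) (∑-last (h + h) inner) ⟨
    ∑[ i < suc (suc (h + h)) ] g i                  ≡⟨ cong (λ k → ∑[ i < k ] g i) (+-suc-suc h h) ⟨
    ∑[ i < suc h + suc h ] g i                      ∎
    where
    open ≡-Reasoning
    swap : ∀ x a → x + (a + a) ≡ a + (x + a)
    swap = solve-∀

indicator : Bool → ℕ
indicator true  = 1
indicator false = 0

indicator-¬T : ∀ {b} → ¬ T b → indicator b ≡ 0
indicator-¬T {true}  ¬t = contradiction _ ¬t
indicator-¬T {false} ¬t = refl

length-filterᵇ : ∀ {A : Set} (p : A → Bool) xs → length (filterᵇ p xs) ≡ sum (map (indicator ∘ p) xs)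
length-filterᵇ p []       = refl
length-filterᵇ p (x ∷ xs) with p x
... | true  = cong suc (length-filterᵇ p xs)
... | false = length-filterᵇ p xs

coprime-transfer : ∀ {a b n} → (∀ {d} → d ∣ n → d ∣ b → d ∣ a) → Coprime a n → Coprime b n
coprime-transfer d∣a cop (d∣b , d∣n) = cop (d∣a d∣n d∣b , d∣n)

coprime-complement : ∀ {a b n} → n ∣ a + b → Coprime a n → Coprime b n
coprime-complement {a} {b} n∣a+b = coprime-transfer λ {d} d∣n d∣b →
  ∣m+n∣m⇒∣n (subst (d ∣_) (+-comm a b) (∣-trans d∣n n∣a+b)) d∣b

Admissible : ℕ → ℕ → ℕ → Set
Admissible m n k = ∀ s → s < m → Coprime (k + s) n

admissible : ℕ → ℕ → ℕ → Bool
admissible m n k = all (λ s → gcd (k + s) n ≡ᵇ 1) (upTo m)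

T-gcd≡ᵇ1⇔Coprime : ∀ a n → T (gcd a n ≡ᵇ 1) ⇔ Coprime a n
T-gcd≡ᵇ1⇔Coprime a n = mk⇔ (gcd≡1⇒coprime ∘ ≡ᵇ⇒≡ (gcd a n) 1) (≡⇒≡ᵇ (gcd a n) 1 ∘ coprime⇒gcd≡1)

T-admissible⇔Admissible : ∀ m n k → T (admissible m n k) ⇔ Admissible m n k
T-admissible⇔Admissible m n k = mk⇔ to from
  where
  coprime⇔ : ∀ s → T (gcd (k + s) n ≡ᵇ 1) ⇔ Coprime (k + s) n
  coprime⇔ s = T-gcd≡ᵇ1⇔Coprime (k + s) n
  to : T (admissible m n k) → Admissible m n k
  to adm s s<m = Equivalence.to (coprime⇔ s) (All.lookup (all⁺ _ (upTo m) adm) (∈-upTo⁺ s<m))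
  from : Admissible m n k → T (admissible m n k)
  from adm = all⁻ _ (All.tabulate λ {s} s∈ → Equivalence.from (coprime⇔ s) (adm s (∈-upTo⁻ s∈)))

admissible-cong : ∀ m n a b → (Admissible m n a ⇔ Admissible m n b) → admissible m n a ≡ admissible m n b
admissible-cong m n a b a⇔b = ⇔→≡ (⇔.trans (⇔.sym T-≡) (⇔.trans T[a]⇔T[b] T-≡))
  where
  T[a]⇔T[b] : T (admissible m n a) ⇔ T (admissible m n b)
  T[a]⇔T[b] = ⇔.trans (T-admissible⇔Admissible m n a)
                (⇔.trans a⇔b (⇔.sym (T-admissible⇔Admissible m n b)))

L-as-∑ : ∀ m n → L m n ≡ ∑[ i < n ] indicator (admissible m n (suc i))
L-as-∑ m n = begin
  length (filterᵇ (admissible m n) (map suc (upTo n)))      ≡⟨ length-filterᵇ (admissible m n) (map suc (upTo n)) ⟩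
  sum (map (indicator ∘ admissible m n) (map suc (upTo n))) ≡⟨ cong (sum ∘ map _) (map-upTo suc n) ⟩
  sum (map (indicator ∘ admissible m n) (applyUpTo suc n))  ≡⟨ cong sum (map-applyUpTo suc _ n) ⟩
  ∑[ i < n ] indicator (admissible m n (suc i))             ∎
  where open ≡-Reasoning

Admissible-periodic : ∀ m n k → Admissible m n (k + n) ⇔ Admissible m n k
Admissible-periodic m n k = mk⇔ to from
  where
  shift : ∀ s → k + n + s ≡ (k + s) + n
  shift s = +-right-comm k n s
    where
    +-right-comm : ∀ x y z → x + y + z ≡ x + z + y
    +-right-comm = solve-∀
  to : Admissible m n (k + n) → Admissible m n k
  to adm s s<m = coprime-transfer {k + n + s} (λ {d} d∣n d∣k+s →
    subst (d ∣_) (sym (shift s)) (∣m∣n⇒∣m+n d∣k+s d∣n)) (adm s s<m)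
  from : Admissible m n k → Admissible m n (k + n)
  from adm s s<m = coprime-transfer {k + s} (λ {d} d∣n d∣k+n+s →
    ∣m+n∣m⇒∣n (subst (d ∣_) (trans (shift s) (+-comm (k + s) n)) d∣k+n+s) d∣n) (adm s s<m)

-- The window of b is the window of a reflected modulo n: (b + s) + (a + (e ∸ s)) ≡ 0 (mod n).
Admissible-reflect : ∀ e n a b → n ∣ a + b + e → Admissible (suc e) n a → Admissible (suc e) n b
Admissible-reflect e n a b n∣a+b+e adm s (s≤s s≤e) =
  coprime-complement {a + (e ∸ s)} {b + s} n∣sum (adm (e ∸ s) (s≤s (m∸n≤m e s)))
  where
  regroup : ∀ a b u s → a + u + (b + s) ≡ a + b + (u + s)
  regroup = solve-∀
  n∣sum : n ∣ a + (e ∸ s) + (b + s)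
  n∣sum = subst (n ∣_) (sym (trans (regroup a b (e ∸ s) s) (cong (a + b +_) (m∸n+n≡m s≤e)))) n∣a+b+e

¬Admissible : ∀ {m n k d} s → s < m → 2 ≤ d → d ∣ n → d ∣ k + s → ¬ Admissible m n k
¬Admissible s s<m 2≤d d∣n d∣k+s adm = <⇒≢ 2≤d (sym (adm s s<m (d∣k+s , d∣n)))

L<n : ∀ {m n} → 1 ≤ m → 2 ≤ n → L m n < n
L<n {m} {n@(suc _)} 1≤m 2≤n = begin-strict
  L m n                     <⟨ filter-notAll (T? ∘ admissible m n) (map suc (upTo n)) (lose n∈ n-inadmissible) ⟩
  length (map suc (upTo n)) ≡⟨ length-map suc (upTo n) ⟩
  length (upTo n)           ≡⟨ length-upTo n ⟩
  n                         ∎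
  where
  open ≤-Reasoning
  n∈ : n ∈ map suc (upTo n)
  n∈ = ∈-map⁺ suc (∈-upTo⁺ ≤-refl)
  n-inadmissible : ¬ T (admissible m n n)
  n-inadmissible = ¬Admissible 0 1≤m 2≤n ∣-refl (subst (n ∣_) (sym (+-identityʳ n)) ∣-refl)
                 ∘ Equivalence.to (T-admissible⇔Admissible m n n)

even-or-odd : ∀ n → ∃ λ h → n ≡ h + h ⊎ n ≡ suc (h + h)
even-or-odd zero    = 0 , inj₁ refl
even-or-odd (suc n) with even-or-odd n
... | h , inj₁ n≡h+h   = h , inj₂ (cong suc n≡h+h)
... | h , inj₂ n≡1+h+h = suc h , inj₁ (trans (cong suc n≡1+h+h) (cong suc (sym (+-suc h h))))

∃s<2[2∣k+s] : ∀ k → ∃ λ s → s < 2 × 2 ∣ k + s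
∃s<2[2∣k+s] k with even-or-odd k
... | h , inj₁ k≡h+h   = 0 , s≤s z≤n , subst (2 ∣_) (sym (trans (+-identityʳ k) k≡h+h)) (2∣n+n h)
... | h , inj₂ k≡1+h+h = 1 , ≤-refl , subst (2 ∣_) (sym k+1≡1+h+1+h) (2∣n+n (suc h))
  where
  k+1≡1+h+1+h : k + 1 ≡ suc h + suc h
  k+1≡1+h+1+h = trans (+-comm k 1) (trans (cong suc k≡1+h+h) (cong suc (sym (+-suc h h))))

2∣n⇒L≡0 : ∀ {m n} → 2 ≤ m → 2 ∣ n → L m n ≡ 0
2∣n⇒L≡0 {m} {n} 2≤m 2∣n =
  cong length (filter-none (T? ∘ admissible m n) (All.universal inadmissible (map suc (upTo n))))
  where
  inadmissible : ∀ k → ¬ T (admissible m n k)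
  inadmissible k with s , s<2 , 2∣k+s ← ∃s<2[2∣k+s] k =
    ¬Admissible s (≤-trans s<2 2≤m) ≤-refl 2∣n 2∣k+s ∘ Equivalence.to (T-admissible⇔Admissible m n k)

2∣L-odd : ∀ t h → 1 ≤ h → 2 ∣ L (suc (2 * t)) (suc (h + h))
2∣L-odd t h 1≤h =
  subst (2 ∣_) (sym L≡f[c]+∑g)
    (subst (2 ∣_) (cong (_+ ∑[ i < h + h ] g i) (sym f[c]≡0)) (2∣∑-palindrome h g g-palindromic))
  where
  m = suc (2 * t)
  n = suc (h + h)
  -- The fixed point of the reflection: c + t ≡ n * t.
  c = h * (2 * t)
  f : ℕ → ℕ
  f k = indicator (admissible m n k)
  g : ℕ → ℕ
  g i = f (c + suc i)
  f-periodic : Periodic n f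
  f-periodic k = cong indicator (admissible-cong m n (k + n) k (Admissible-periodic m n k))
  f[c]≡0 : f (c + 0) ≡ 0
  f[c]≡0 = indicator-¬T (¬Admissible t (s≤s (m≤m+n t (t + 0))) (s≤s (≤-trans 1≤h (m≤m+n h h))) ∣-refl n∣c+0+t
                         ∘ Equivalence.to (T-admissible⇔Admissible m n (c + 0)))
    where
    identity : ∀ h t → h * (2 * t) + 0 + t ≡ t * suc (h + h)
    identity = solve-∀
    n∣c+0+t : n ∣ c + 0 + t
    n∣c+0+t = divides t (identity h t)
  n∣reflection : ∀ i j → suc (i + j) ≡ h + h → n ∣ (c + suc i) + (c + suc j) + 2 * t
  n∣reflection i j i+j+1≡h+h =
    divides m (trans (regroup c i j t) (trans (cong (λ x → c + c + 2 * t + suc x) i+j+1≡h+h) (identity h t)))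
    where
    regroup : ∀ c i j t → c + suc i + (c + suc j) + 2 * t ≡ c + c + 2 * t + suc (suc (i + j))
    regroup = solve-∀
    identity : ∀ h t → h * (2 * t) + h * (2 * t) + 2 * t + suc (h + h) ≡ suc (2 * t) * suc (h + h)
    identity = solve-∀
  g-palindromic : ∀ i j → suc (i + j) ≡ h + h → g i ≡ g j
  g-palindromic i j i+j+1≡h+h = cong indicator (admissible-cong m n (c + suc i) (c + suc j)
    (mk⇔ (Admissible-reflect (2 * t) n _ _ (n∣reflection i j i+j+1≡h+h))
         (Admissible-reflect (2 * t) n _ _ (n∣reflection j i (trans (cong suc (+-comm j i)) i+j+1≡h+h)))))
  L≡f[c]+∑g : L m n ≡ f (c + 0) + ∑[ i < h + h ] g i
  L≡f[c]+∑g = begin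
    L m n                 ≡⟨ L-as-∑ m n ⟩
    ∑[ i < n ] f (suc i)  ≡⟨ ∑-rotate 1 n f f-periodic ⟩
    ∑[ i < n ] f i        ≡⟨ ∑-rotate c n f f-periodic ⟨
    ∑[ i < n ] f (c + i)  ∎
    where open ≡-Reasoning

2∣L : ∀ {m n} → Odd m → 2 ≤ m → 2 ≤ n → 2 ∣ L m n
2∣L {m} {n} (t , refl) 2≤m 2≤n with even-or-odd n
... | h     , inj₁ refl = subst (2 ∣_) (sym (2∣n⇒L≡0 2≤m (2∣n+n h))) (2 ∣0)
... | zero  , inj₂ refl = contradiction 2≤n λ { (s≤s ()) }
... | suc h , inj₂ refl = 2∣L-odd t (suc h) (s≤s z≤n)

IsR-1 : ∀ {m n} → ZeroOrOne (L m n) → IsR m n 1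
IsR-1 L∈01 = ≤-refl , L∈01 , λ { j 1≤j (s≤s j≤0) _ → contradiction (≤-trans 1≤j j≤0) λ () }

IsR-2 : ∀ {m n} → ¬ ZeroOrOne (L m n) → ZeroOrOne (L m (L m n)) → IsR m n 2
IsR-2 L∉01 LL∈01 = s≤s z≤n , LL∈01 , λ
  { (suc zero)    _ _ L∈01             → L∉01 L∈01
  ; (suc (suc j)) _ (s≤s (s≤s ())) _
  }

D<n : ∀ {m n} → 1 < n → L m n < n → L m n ≢ 1 → L m (L m n) ≡ 0 → ∃ λ d → IsD m n d × d < n
D<n {m} {n} 1<n Ln<n Ln≢1 LLn≡0 with L m n ≟ 0
... | yes Ln≡0 = iterSum m n 1 , inj₂ (1<n , 1 , IsR-1 (inj₁ Ln≡0) , refl) , Ln+0<n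
  where
  Ln+0<n : L m n + 0 < n
  Ln+0<n = subst (_< n) (sym (+-identityʳ (L m n))) Ln<n
... | no Ln≢0  = iterSum m n 2 , inj₂ (1<n , 2 , IsR-2 (Sum.[ Ln≢0 , Ln≢1 ]) (inj₁ LLn≡0) , refl) , Ln+LLn+0<n
  where
  Ln+LLn+0<n : L m n + (L m (L m n) + 0) < n
  Ln+LLn+0<n = subst (λ x → L m n + (x + 0) < n) (sym LLn≡0) (subst (_< n) (sym (+-identityʳ (L m n))) Ln<n)

theorem2p1 : (m : ℕ) → Odd m → 1 < m →
    (n : ℕ) → 1 ≤ n → ∃ (λ d → IsD m n d × d < n)
theorem2p1 m odd 1<m (suc zero)        _ = 0 , inj₁ (refl , refl) , ≤-refl
theorem2p1 m odd 1<m n@(suc (suc _)) _ =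
  D<n 1<n (L<n (<⇒≤ 1<m) 1<n) Ln≢1 (2∣n⇒L≡0 1<m 2∣Ln)
  where
  1<n : 1 < n
  1<n = s≤s (s≤s z≤n)
  2∣Ln : 2 ∣ L m n
  2∣Ln = 2∣L odd 1<m 1<n
  Ln≢1 : L m n ≢ 1
  Ln≢1 Ln≡1 = contradiction (∣1⇒≡1 (subst (2 ∣_) Ln≡1 2∣Ln)) λ ()
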